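{- (a) Let $G$ be a finite group of even order, and let $T$ be the set consisting of the identity and the involutions of $G$. Then the matching number of the power graph $P(G)$, and also that of the enhanced power graph $P_e(G)$, is at least $1+(|G|-|T|)/2$. (b) If $G$ is a finite group with a unique involution, then $P(G)$ has a perfect matching.
   Context: For a finite group $G$, the power graph $P(G)$ is the simple undirected graph with vertex set $G$ in which distinct $x,y$ are adjacent iff one is a power of the other. The enhanced power graph $P_e(G)$ has vertex set $G$, with distinct $x,y$ adjacent iff $\langle x,y\rangle$ is cyclic. The matching number of a graph is the maximum number of edges in a matching (a set of pairwise vertex-disjoint edges). A perfect matching is a matching covering every vertex. -}

module Defs where

open import Level using (0ℓ)
open import Data.Nat using (ℕ; zero; suc; _+_; _*_; _∸_; _≤_)
open import Data.Fin using (Fin)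
open import Data.Fin.Properties using (_≟_)
open import Data.List using (List; []; _∷_; length; concatMap; filter)
open import Data.List.Relation.Unary.All using (All)
open import Data.List.Relation.Unary.Unique.Propositional using (Unique)
open import Data.List.Membership.Propositional using (_∈_)
open import Data.Product using (Σ; ∃; _×_; _,_; proj₁; proj₂)
open import Data.Vec.Functional using (Vector)
open import Data.List using (allFin)
open import Relation.Binary.PropositionalEquality using (_≡_; _≢_)
open import Algebra.Structures using (IsGroup)

-- A finite group of order n: a group structure on Fin n (every finite group
-- is isomorphic to one of this form), with propositional equality.
record FiniteGroup : Set where
  field
    order   : ℕ
    _∙_     : Fin order → Fin order → Fin order
    ε       : Fin order
    _⁻¹     : Fin order → Fin order
    isGroup : IsGroup _≡_ _∙_ ε _⁻¹

  Elt : Set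
  Elt = Fin order

  pow : Elt → ℕ → Elt
  pow x zero    = ε
  pow x (suc k) = x ∙ pow x k

  IsPowerOf : Elt → Elt → Set
  IsPowerOf y x = ∃ λ k → y ≡ pow x k

  IsInvolution : Elt → Set
  IsInvolution x = x ≢ ε × (x ∙ x) ≡ ε

  -- |T|, T = {identity} ∪ {involutions} = {x | x * x = e}
  sizeT : ℕ
  sizeT = length (filter (λ x → (x ∙ x) ≟ ε) (allFin order))

  -- ⟨x , y⟩ is cyclic  iff  x and y both lie in some cyclic subgroup ⟨z⟩
  GeneratesCyclic : Elt → Elt → Set
  GeneratesCyclic x y = ∃ λ z → IsPowerOf x z × IsPowerOf y z

  PowerAdj : Elt → Elt → Set
  PowerAdj x y = x ≢ y × (IsPowerOf y x Data.Sum.⊎ IsPowerOf x y)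
    where import Data.Sum

  EnhancedAdj : Elt → Elt → Set
  EnhancedAdj x y = x ≢ y × GeneratesCyclic x y

module _ {n : ℕ} (Adj : Fin n → Fin n → Set) where

  endpoints : List (Fin n × Fin n) → List (Fin n)
  endpoints = concatMap (λ e → proj₁ e ∷ proj₂ e ∷ [])

  IsMatching : List (Fin n × Fin n) → Set
  IsMatching M = All (λ e → Adj (proj₁ e) (proj₂ e)) M × Unique (endpoints M)


  HasPerfectMatching : Set
  HasPerfectMatching =
    Σ (List (Fin n × Fin n)) λ M → IsMatching M × (∀ v → v ∈ endpoints M)

{-# OPTIONS --safe #-}
-- Inversion is an involution of G whose fixed points are exactly the elements of T,
-- and x⁻¹ is a power of x.  Pairing each x ∉ T with x⁻¹ therefore gives (|G| − |T|)/2
-- disjoint edges of P(G), hence of P_e(G), and shows |G| = |T| + 2·#pairs.  If |G| is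
-- even, so is |T|; as e ∈ T, G has an involution t, and {t, e} is one more disjoint
-- edge.  If t is the only involution, T = {e, t} and this matching is perfect.
module Submission where

open import Defs
open import Data.Nat using (ℕ; zero; suc; _+_; _*_; _∸_; _≤_)
open import Data.Nat.Divisibility using (_∣_)
open import Data.List using (List; length)
open import Data.Product using (Σ; _×_)
open import Relation.Binary.PropositionalEquality using (_≡_)

open import Level using (0ℓ)
open import Algebra.Bundles using (Group)
open import Algebra.Structures using (IsGroup)
open import Data.Empty using (⊥-elim)
open import Data.Fin using (Fin; toℕ; _<_)
open import Data.Fin.Properties using (_≟_; _<?_; <-cmp; <-asym; <⇒≢; pigeonhole)
open import Data.List using ([]; _∷_; _++_; filter; allFin; map)
open import Data.List.Properties using (length-++; length-tabulate; filter-≐)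
open import Data.List.Membership.Propositional using (_∈_; find)
open import Data.List.Membership.Propositional.Properties using (∈-filter⁺; ∈-filter⁻; ∈-allFin; ∈-++⁺ˡ; ∈-++⁺ʳ)
open import Data.List.Membership.Propositional.Properties.WithK using (unique∧set⇒bag)
open import Data.List.Relation.Binary.BagAndSetEquality using (_∼[_]_; set; ∼bag⇒↭)
open import Data.List.Relation.Binary.Permutation.Propositional.Properties using (↭-length)
open import Data.List.Relation.Unary.All as All using (All; []; _∷_; all?)
open import Data.List.Relation.Unary.All.Properties using (map⁺; all-filter; ¬All⇒Any¬)
open import Data.List.Relation.Unary.Any using (here; there)
open import Data.List.Relation.Unary.Unique.Propositional using (Unique; []; _∷_)
open import Data.List.Relation.Unary.Unique.Propositional.Properties using (allFin⁺; filter⁺; ++⁺)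
open import Data.Nat.Divisibility using (∣m+n∣m⇒∣n; m∣m*n; ∣1⇒≡1)
open import Data.Nat.Properties using (n<1+n; m+[n∸m]≡n; +-suc; *-suc; +-comm; m+n∸m≡n; ≤-reflexive)
open import Data.Product using (∃; _,_; proj₁; proj₂)
open import Data.Sum using (_⊎_; inj₁; inj₂)
open import Function.Bundles using (Equivalence; _⇔_; mk⇔)
open import Relation.Binary.Definitions using (tri<; tri≈; tri>)
open import Relation.Binary.PropositionalEquality using (_≢_; refl; sym; trans; cong; subst; module ≡-Reasoning)
open import Relation.Nullary using (yes; no)

unique∧set⇒length-≡ : {A : Set} {xs ys : List A} →
                      Unique xs → Unique ys → xs ∼[ set ] ys → length xs ≡ length ys
unique∧set⇒length-≡ !xs !ys xs∼ys = ↭-length (∼bag⇒↭ (unique∧set⇒bag !xs !ys xs∼ys))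

length-endpoints : {n : ℕ} (Adj : Fin n → Fin n → Set) (M : List (Fin n × Fin n)) →
                   length (endpoints Adj M) ≡ 2 * length M
length-endpoints Adj []      = refl
length-endpoints Adj (_ ∷ M) = trans (cong (λ k → 2 + k) (length-endpoints Adj M)) (sym (*-suc 2 (length M)))

isMatching-mono : {n : ℕ} {Adj Adj′ : Fin n → Fin n → Set} → (∀ {x y} → Adj x y → Adj′ x y) →
                  {M : List (Fin n × Fin n)} → IsMatching Adj M → IsMatching Adj′ M
isMatching-mono Adj⇒Adj′ (adjacent , distinct) = All.map Adj⇒Adj′ adjacent , distinct

module InvolutionOrbits {n : ℕ} (f : Fin n → Fin n) (f-involutive : ∀ x → f (f x) ≡ x)
                        (Adj : Fin n → Fin n → Set) (orbit-adj : ∀ {x} → x ≢ f x → Adj x (f x)) where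

  f-injective : ∀ {x y} → f x ≡ f y → x ≡ y
  f-injective {x} {y} fx≡fy = trans (sym (f-involutive x)) (trans (cong f fx≡fy) (f-involutive y))

  -- Each two-element orbit {x, f x} is represented by its smaller element in Fin n.
  lowerPoints : List (Fin n)
  lowerPoints = filter (λ x → x <? f x) (allFin n)

  fixedPoints : List (Fin n)
  fixedPoints = filter (λ x → f x ≟ x) (allFin n)

  orbitPairsOf : List (Fin n) → List (Fin n × Fin n)
  orbitPairsOf = map (λ x → x , f x)

  orbitPairs : List (Fin n × Fin n)
  orbitPairs = orbitPairsOf lowerPoints

  orbitPoints : List (Fin n)
  orbitPoints = endpoints Adj orbitPairs

  InOrbitOf : Fin n → Fin n → Set
  InOrbitOf x v = v ≡ x ⊎ v ≡ f x

  lower-points-not-paired : ∀ {x y} → x < f x → y < f y → x ≢ f y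
  lower-points-not-paired {x} {y} x<fx y<fy x≡fy =
    <-asym (subst (x <_) (trans (cong f x≡fy) (f-involutive y)) x<fx) (subst (y <_) (sym x≡fy) y<fy)

  lower-orbit-representative-unique : ∀ {x y v} → x < f x → y < f y →
                                      InOrbitOf x v → InOrbitOf y v → x ≡ y
  lower-orbit-representative-unique _    _    (inj₁ refl) (inj₁ v≡y)  = v≡y
  lower-orbit-representative-unique _    _    (inj₂ refl) (inj₂ v≡fy) = f-injective v≡fy
  lower-orbit-representative-unique x<fx y<fy (inj₁ refl) (inj₂ x≡fy) =
    ⊥-elim (lower-points-not-paired x<fx y<fy x≡fy)
  lower-orbit-representative-unique x<fx y<fy (inj₂ refl) (inj₁ fx≡y) =
    ⊥-elim (lower-points-not-paired y<fy x<fx (sym fx≡y))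

  ∈-orbitPointsOf⁻ : ∀ L {v} → v ∈ endpoints Adj (orbitPairsOf L) → ∃ λ x → x ∈ L × InOrbitOf x v
  ∈-orbitPointsOf⁻ (x ∷ L) (here v≡x)         = x , here refl , inj₁ v≡x
  ∈-orbitPointsOf⁻ (x ∷ L) (there (here v≡fx)) = x , here refl , inj₂ v≡fx
  ∈-orbitPointsOf⁻ (x ∷ L) (there (there v∈)) =
    let y , y∈L , v∈orbit = ∈-orbitPointsOf⁻ L v∈ in y , there y∈L , v∈orbit

  ∈-orbitPointsOf⁺ : ∀ {L x v} → x ∈ L → InOrbitOf x v → v ∈ endpoints Adj (orbitPairsOf L)
  ∈-orbitPointsOf⁺ (here refl) (inj₁ refl) = here refl
  ∈-orbitPointsOf⁺ (here refl) (inj₂ refl) = there (here refl)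
  ∈-orbitPointsOf⁺ (there x∈L) v∈orbit     = there (there (∈-orbitPointsOf⁺ x∈L v∈orbit))

  orbitPointsOf-unique : ∀ {L} → Unique L → All (λ x → x < f x) L → Unique (endpoints Adj (orbitPairsOf L))
  orbitPointsOf-unique {[]}    []          []             = []
  orbitPointsOf-unique {x ∷ L} (x∉L ∷ !L) (x<fx ∷ lowerL) =
    (<⇒≢ x<fx ∷ All.tabulate (outside (inj₁ refl))) ∷ All.tabulate (outside (inj₂ refl))
      ∷ orbitPointsOf-unique !L lowerL
    where
      outside : ∀ {v w} → InOrbitOf x v → w ∈ endpoints Adj (orbitPairsOf L) → v ≢ w
      outside v∈orbit w∈ refl =
        let y , y∈L , w∈orbit = ∈-orbitPointsOf⁻ L w∈ in
        All.lookup x∉L y∈L (lower-orbit-representative-unique x<fx (All.lookup lowerL y∈L) v∈orbit w∈orbit)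

  lowerPoints-lower : All (λ x → x < f x) lowerPoints
  lowerPoints-lower = all-filter (λ x → x <? f x) (allFin n)

  ∈-lowerPoints : ∀ {x} → x < f x → x ∈ lowerPoints
  ∈-lowerPoints {x} = ∈-filter⁺ (λ x → x <? f x) (∈-allFin x)

  orbitPoints-unique : Unique orbitPoints
  orbitPoints-unique = orbitPointsOf-unique (filter⁺ (λ x → x <? f x) (allFin⁺ n)) lowerPoints-lower

  orbitPoint-unfixed : ∀ {v} → v ∈ orbitPoints → f v ≢ v
  orbitPoint-unfixed v∈ with ∈-orbitPointsOf⁻ lowerPoints v∈
  ... | x , x∈ , inj₁ refl = λ fx≡x → <⇒≢ (All.lookup lowerPoints-lower x∈) (sym fx≡x)
  ... | x , x∈ , inj₂ refl = λ ffx≡fx → <⇒≢ (All.lookup lowerPoints-lower x∈) (trans (sym (f-involutive x)) ffx≡fx)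

  unfixed∈orbitPoints : ∀ {v} → f v ≢ v → v ∈ orbitPoints
  unfixed∈orbitPoints {v} fv≢v with <-cmp v (f v)
  ... | tri< v<fv _ _ = ∈-orbitPointsOf⁺ (∈-lowerPoints v<fv) (inj₁ refl)
  ... | tri≈ _ v≡fv _ = ⊥-elim (fv≢v (sym v≡fv))
  ... | tri> _ _ fv<v = ∈-orbitPointsOf⁺ (∈-lowerPoints (subst (f v <_) (sym (f-involutive v)) fv<v))
                                          (inj₂ (sym (f-involutive v)))

  orbitPairs-adjacent : All (λ e → Adj (proj₁ e) (proj₂ e)) orbitPairs
  orbitPairs-adjacent = map⁺ (All.map (λ x<fx → orbit-adj (<⇒≢ x<fx)) lowerPoints-lower)

  n≡#fixed+2*#orbits : n ≡ length fixedPoints + 2 * length orbitPairs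
  n≡#fixed+2*#orbits = begin
    n                                           ≡⟨ sym (length-tabulate (λ x → x)) ⟩
    length (allFin n)                           ≡⟨ unique∧set⇒length-≡ (allFin⁺ n) !fixed++orbit all∼fixed++orbit ⟩
    length (fixedPoints ++ orbitPoints)         ≡⟨ length-++ fixedPoints ⟩
    length fixedPoints + length orbitPoints     ≡⟨ cong (length fixedPoints +_) (length-endpoints Adj orbitPairs) ⟩
    length fixedPoints + 2 * length orbitPairs  ∎
    where
      open ≡-Reasoning
      fixed-or-orbit : ∀ v → v ∈ fixedPoints ++ orbitPoints
      fixed-or-orbit v with f v ≟ v
      ... | yes fv≡v = ∈-++⁺ˡ (∈-filter⁺ (λ x → f x ≟ x) (∈-allFin v) fv≡v)
      ... | no  fv≢v = ∈-++⁺ʳ fixedPoints (unfixed∈orbitPoints fv≢v)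
      all∼fixed++orbit : allFin n ∼[ set ] fixedPoints ++ orbitPoints
      all∼fixed++orbit {v} = mk⇔ (λ _ → fixed-or-orbit v) (λ _ → ∈-allFin v)
      !fixed++orbit : Unique (fixedPoints ++ orbitPoints)
      !fixed++orbit = ++⁺ (filter⁺ (λ x → f x ≟ x) (allFin⁺ n)) orbitPoints-unique
        λ (v∈fixed , v∈orbit) → orbitPoint-unfixed v∈orbit (proj₂ (∈-filter⁻ (λ x → f x ≟ x) {xs = allFin n} v∈fixed))

  fixedEdge+orbitPairs-isMatching : ∀ {a b} → f a ≡ a → f b ≡ b → a ≢ b → Adj a b →
                                    IsMatching Adj ((a , b) ∷ orbitPairs)
  fixedEdge+orbitPairs-isMatching fa≡a fb≡b a≢b a~b =
      a~b ∷ orbitPairs-adjacent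
    , (a≢b ∷ All.tabulate (fixed≢orbitPoint fa≡a)) ∷ All.tabulate (fixed≢orbitPoint fb≡b) ∷ orbitPoints-unique
    where
      fixed≢orbitPoint : ∀ {x v} → f x ≡ x → v ∈ orbitPoints → x ≢ v
      fixed≢orbitPoint fx≡x v∈ refl = orbitPoint-unfixed v∈ fx≡x

  fixedEdge+orbitPairs-covers : ∀ {a b} → (∀ v → f v ≡ v → v ≡ a ⊎ v ≡ b) →
                                ∀ v → v ∈ endpoints Adj ((a , b) ∷ orbitPairs)
  fixedEdge+orbitPairs-covers fixed⇒a∨b v with f v ≟ v
  ... | no  fv≢v = there (there (unfixed∈orbitPoints fv≢v))
  ... | yes fv≡v with fixed⇒a∨b v fv≡v
  ...   | inj₁ v≡a = here v≡a
  ...   | inj₂ v≡b = there (here v≡b)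

module FiniteGroupProperties (G : FiniteGroup) where
  open FiniteGroup G
  open IsGroup isGroup using (assoc; identityˡ; identityʳ; inverseʳ)

  group : Group 0ℓ 0ℓ
  group = record { isGroup = isGroup }

  open import Algebra.Properties.Group group using (identityʳ-unique; inverseˡ-unique; inverseʳ-unique; ε⁻¹≈ε; ⁻¹-involutive)

  pow-+ : ∀ x m n → pow x (m + n) ≡ pow x m ∙ pow x n
  pow-+ x zero    n = sym (identityˡ (pow x n))
  pow-+ x (suc m) n = trans (cong (x ∙_) (pow-+ x m n)) (sym (assoc x (pow x m) (pow x n)))

  -- The order + 1 powers x⁰, …, x^order cannot all be distinct.
  pow-returns-to-ε : ∀ x → ∃ λ k → pow x (suc k) ≡ ε
  pow-returns-to-ε x with pigeonhole (n<1+n order) (λ (i : Fin (suc order)) → pow x (toℕ i))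
  ... | i , j , i<j , xⁱ≡xʲ = k , identityʳ-unique (pow x (toℕ i)) (pow x (suc k)) xⁱ⁺ᵏ⁺¹≡xⁱ
    where
      open ≡-Reasoning
      k = toℕ j ∸ suc (toℕ i)
      xⁱ⁺ᵏ⁺¹≡xⁱ : pow x (toℕ i) ∙ pow x (suc k) ≡ pow x (toℕ i)
      xⁱ⁺ᵏ⁺¹≡xⁱ = begin
        pow x (toℕ i) ∙ pow x (suc k) ≡⟨ sym (pow-+ x (toℕ i) (suc k)) ⟩
        pow x (toℕ i + suc k)         ≡⟨ cong (pow x) (trans (+-suc (toℕ i) k) (m+[n∸m]≡n i<j)) ⟩
        pow x (toℕ j)                 ≡⟨ sym xⁱ≡xʲ ⟩
        pow x (toℕ i)                 ∎

  inverse-isPowerOf : ∀ x → IsPowerOf (x ⁻¹) x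
  inverse-isPowerOf x =
    let k , xᵏ⁺¹≡ε = pow-returns-to-ε x in k , sym (inverseʳ-unique x (pow x k) xᵏ⁺¹≡ε)

  square≡ε⇔selfInverse : ∀ x → (x ∙ x ≡ ε) ⇔ (x ⁻¹ ≡ x)
  square≡ε⇔selfInverse x = mk⇔ (λ x²≡ε → sym (inverseˡ-unique x x x²≡ε))
                                (λ x⁻¹≡x → trans (cong (x ∙_) (sym x⁻¹≡x)) (inverseʳ x))

  powerAdj⇒enhancedAdj : ∀ {x y} → PowerAdj x y → EnhancedAdj x y
  powerAdj⇒enhancedAdj (x≢y , inj₁ y∈⟨x⟩) = x≢y , _ , (1 , sym (identityʳ _)) , y∈⟨x⟩
  powerAdj⇒enhancedAdj (x≢y , inj₂ x∈⟨y⟩) = x≢y , _ , x∈⟨y⟩ , (1 , sym (identityʳ _))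

  open InvolutionOrbits _⁻¹ ⁻¹-involutive PowerAdj (λ {x} x≢x⁻¹ → x≢x⁻¹ , inj₁ (inverse-isPowerOf x))

  T : List Elt
  T = filter (λ x → x ∙ x ≟ ε) (allFin order)

  sizeT≡#fixed : sizeT ≡ length fixedPoints
  sizeT≡#fixed = cong length (filter-≐ (λ x → x ∙ x ≟ ε) (λ x → x ⁻¹ ≟ x)
                                       ((λ {x} → Equivalence.to (square≡ε⇔selfInverse x)) ,
                                        (λ {x} → Equivalence.from (square≡ε⇔selfInverse x)))
                                       (allFin order))

  order≡sizeT+2*#orbits : order ≡ sizeT + 2 * length orbitPairs
  order≡sizeT+2*#orbits = trans n≡#fixed+2*#orbits (cong (_+ 2 * length orbitPairs) (sym sizeT≡#fixed))

  sizeT-even : 2 ∣ order → 2 ∣ sizeT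
  sizeT-even 2∣order =
    ∣m+n∣m⇒∣n (subst (2 ∣_) (trans order≡sizeT+2*#orbits (+-comm sizeT _)) 2∣order) (m∣m*n (length orbitPairs))

  sizeT≡1 : All (_≡ ε) T → sizeT ≡ 1
  sizeT≡1 T≡ε = unique∧set⇒length-≡ (filter⁺ (λ x → x ∙ x ≟ ε) (allFin⁺ order)) ([] ∷ [])
                  (mk⇔ (λ t∈T → here (All.lookup T≡ε t∈T)) λ { (here refl) → ε∈T })
    where ε∈T = ∈-filter⁺ (λ x → x ∙ x ≟ ε) (∈-allFin ε) (identityˡ ε)

  involution-exists : 2 ∣ order → ∃ IsInvolution
  involution-exists 2∣order with all? (_≟ ε) T
  ... | yes T≡ε = ⊥-elim (2≢1 (∣1⇒≡1 (subst (2 ∣_) (sizeT≡1 T≡ε) (sizeT-even 2∣order))))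
    where 2≢1 : 2 ≢ 1
          2≢1 ()
  ... | no  T≢ε =
    let t , t∈T , t≢ε = find (¬All⇒Any¬ (_≟ ε) T T≢ε) in
    t , t≢ε , proj₂ (∈-filter⁻ (λ x → x ∙ x ≟ ε) {xs = allFin order} t∈T)

  involutionEdge+inversePairs-isMatching : ∀ {t} → IsInvolution t → IsMatching PowerAdj ((t , ε) ∷ orbitPairs)
  involutionEdge+inversePairs-isMatching {t} (t≢ε , t²≡ε) =
    fixedEdge+orbitPairs-isMatching (Equivalence.to (square≡ε⇔selfInverse t) t²≡ε) ε⁻¹≈ε t≢ε (t≢ε , inj₁ (0 , refl))

  2+[order∸sizeT]≡2*#edges : ∀ t → 2 + (order ∸ sizeT) ≡ 2 * length ((t , ε) ∷ orbitPairs)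
  2+[order∸sizeT]≡2*#edges t = begin
    2 + (order ∸ sizeT)                            ≡⟨ cong (λ m → 2 + (m ∸ sizeT)) order≡sizeT+2*#orbits ⟩
    2 + (sizeT + 2 * length orbitPairs ∸ sizeT)    ≡⟨ cong (2 +_) (m+n∸m≡n sizeT (2 * length orbitPairs)) ⟩
    2 + 2 * length orbitPairs                      ≡⟨ sym (*-suc 2 (length orbitPairs)) ⟩
    2 * length ((t , ε) ∷ orbitPairs)              ∎
    where open ≡-Reasoning

  evenOrder⇒powerMatching : 2 ∣ order →
    Σ (List (Elt × Elt)) λ M → IsMatching PowerAdj M × 2 + (order ∸ sizeT) ≤ 2 * length M
  evenOrder⇒powerMatching 2∣order =
    let t , t-involution = involution-exists 2∣order in
    (t , ε) ∷ orbitPairs ,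
    involutionEdge+inversePairs-isMatching t-involution ,
    ≤-reflexive (2+[order∸sizeT]≡2*#edges t)

  uniqueInvolution⇒perfectMatching : ∀ {t} → IsInvolution t → (∀ s → IsInvolution s → s ≡ t) →
                                     HasPerfectMatching PowerAdj
  uniqueInvolution⇒perfectMatching {t} t-involution t-unique =
    (t , ε) ∷ orbitPairs , involutionEdge+inversePairs-isMatching t-involution ,
    fixedEdge+orbitPairs-covers selfInverse⇒t∨ε
    where
      selfInverse⇒t∨ε : ∀ v → v ⁻¹ ≡ v → v ≡ t ⊎ v ≡ ε
      selfInverse⇒t∨ε v v⁻¹≡v with v ≟ ε
      ... | yes v≡ε = inj₂ v≡ε
      ... | no  v≢ε = inj₁ (t-unique v (v≢ε , Equivalence.from (square≡ε⇔selfInverse v) v⁻¹≡v))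

mainTheorem2 :
    ((G : FiniteGroup) → let open FiniteGroup G in
       2 ∣ order →
       -- some matching M with |M| ≥ 1 + (|G| - |T|)/2, i.e. 2|M| ≥ 2 + (|G| - |T|)
       (Σ (List (Elt × Elt)) λ M → IsMatching PowerAdj M × 2 + (order ∸ sizeT) ≤ 2 * length M)
       × (Σ (List (Elt × Elt)) λ M → IsMatching EnhancedAdj M × 2 + (order ∸ sizeT) ≤ 2 * length M))
    × ((G : FiniteGroup) → let open FiniteGroup G in
       (Σ Elt λ t → IsInvolution t × (∀ s → IsInvolution s → s ≡ t)) →
       HasPerfectMatching PowerAdj)
mainTheorem2 =
    (λ G 2∣order →
      let open FiniteGroupProperties G
          M , matching , size = evenOrder⇒powerMatching 2∣order
      in (M , matching , size) , (M , isMatching-mono powerAdj⇒enhancedAdj matching , size))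
  , (λ G (t , t-involution , t-unique) →
      FiniteGroupProperties.uniqueInvolution⇒perfectMatching G t-involution t-unique)
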